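{- Let $n\geq 4$ be an integer and let $G=\mathbb{Z}/2^n\mathbb{Z}$. Let $$A := \{(4m+1)2^j \bmod 2^n : m\in\mathbb{Z},\ 0\leq j\leq n-2\}\subseteq G.$$ Then $\phi(A)=4$, $|A|=2^{n-1}-1$, and there do not exist $a_1,a_2\in A$ with $a_1+a_2=0$.
   Context: For subsets $B, A$ of an abelian group $G$, write $B \overset{\ast}{+} B := \{b_1+b_2 : b_1,b_2\in B,\ b_1\neq b_2\}$. A subset $B\subseteq A$ is called sum-avoiding in $A$ if $(B \overset{\ast}{+} B)\cap A=\emptyset$. For a finite set $A$, $\phi(A)$ denotes the largest cardinality of a subset $B\subseteq A$ that is sum-avoiding in $A$. -}

module Defs where

open import Data.Nat using (ℕ; _+_; _^_; _≤_; _∸_; NonZero)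
open import Data.Nat.DivMod using (_%_; m%n<n)
open import Data.Nat.Properties using (m^n≢0)
open import Data.Fin using (Fin; toℕ; fromℕ<)
open import Data.Fin.Subset using (Subset; _∈_)
open import Data.Integer as ℤ using (ℤ; +_)
open import Data.Integer.DivMod using (_%ℕ_)
open import Data.Product using (∃-syntax; _×_)
open import Relation.Binary.PropositionalEquality using (_≡_; _≢_)
open import Relation.Nullary using (¬_)

2^n-nonZero : ∀ n → NonZero (2 ^ n)
2^n-nonZero n = m^n≢0 2 n

G : ℕ → Set
G n = Fin (2 ^ n)

toG : ∀ n → ℕ → G n
toG n k = fromℕ< (m%n<n k (2 ^ n) {{2^n-nonZero n}})

addG : ∀ n → G n → G n → G n
addG n a b = toG n (toℕ a + toℕ b)

0G : ∀ n → G n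
0G n = toG n 0

InA : ∀ n → G n → Set
InA n x = ∃[ m ] ∃[ j ] (j ≤ n ∸ 2 ×
  toℕ x ≡ _%ℕ_ ((+ 4 ℤ.* m ℤ.+ + 1) ℤ.* + (2 ^ j)) (2 ^ n) {{2^n-nonZero n}})

SubsetOfA : ∀ n → Subset (2 ^ n) → Set
SubsetOfA n B = ∀ x → x ∈ B → InA n x

SumAvoiding : ∀ n → Subset (2 ^ n) → Set
SumAvoiding n B = ∀ b₁ b₂ → b₁ ∈ B → b₂ ∈ B → b₁ ≢ b₂ → ¬ InA n (addG n b₁ b₂)

module Submission where

-- Write n = b + 2. Read as residues in [0, 2^n), the elements of A are the numbers
-- (4k+1)·2^j with j ≤ b, and their negatives are the numbers (4k+3)·2^j. Since the
-- odd part of a number is well defined modulo 4, no element of A is the negative of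
-- another. If two distinct elements (4k+1)·2^j and (4k′+1)·2^j′ have j ≡ j′ and
-- k ≡ k′ modulo 2, their sum is again in A: for j + 2 ≤ j′ it is (4s+1)·2^j, and
-- for j = j′ it is (4s+1)·2^(j+1) with 2s = k + k′, where j < b because j = b would
-- force both elements to be 2^b. So a sum-avoiding subset
-- meets each of the four parity classes at most once, while {1, 2, 5, 10} meets each
-- class once and has all its pairwise sums of the form (4k+3)·2^j. Finally A splits
-- into 2·A (for n − 1) and the residues ≡ 1 mod 4, whence |A| = 2^(n−1) − 1 by induction.

open import Defs
open import Data.Bool using (Bool; true; false; if_then_else_)
open import Data.Empty using (⊥-elim)
open import Data.Fin as Fin using (Fin; zero; suc; toℕ; combine; punchOut)
open import Data.Fin.Properties
  using (toℕ<n; toℕ-fromℕ<; toℕ-injective; punchOut-injective; combine-injective)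
  renaming (suc-injective to Fin-suc-injective; 0≢1+n to Fin-0≢1+n)
open import Data.Fin.Subset using (Subset; _∈_; ∣_∣; inside; outside)
open import Data.Integer as ℤ using (+_; -[1+_])
open import Data.Integer.DivMod using (_%ℕ_; _/ℕ_; a≡a%ℕn+[a/ℕn]*n)
import Data.Integer.Properties as ℤ
import Data.Integer.Tactic.RingSolver as ℤ-Solver
open import Data.Nat
  using (ℕ; zero; suc; _+_; _*_; _^_; _∸_; _≤_; _<_; _<?_; _≟_; z≤n; s≤s; z<s; NonZero; parity)
open import Data.Nat.Divisibility using (_∣_; divides; _∣?_; n∣n; ∣m∣n⇒∣m+n; m%n≡0⇒n∣m)
open import Data.Nat.DivMod using (_%_; m<n⇒m%n≡m)
open import Data.Nat.Properties
open import Data.Nat.Tactic.RingSolver using (solve-∀)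
open import Data.Parity.Base as ℙ using (Parity; 0ℙ; 1ℙ)
import Data.Parity.Properties as ℙₚ
open import Data.Product using (∃-syntax; _×_; _,_; proj₁; proj₂)
import Data.Product as Product
open import Data.Sum using (_⊎_; inj₁; inj₂)
open import Data.Vec using (tabulate; _∷_; []; here; there)
open import Data.Vec.Properties using (lookup∘tabulate; []=⇒lookup; lookup⇒[]=)
open import Function using (_∘_)
open import Function.Bundles using (_⇔_; mk⇔; Equivalence)
import Function.Properties.Equivalence as ⇔
open import Relation.Binary.Definitions using (tri<; tri≈; tri>)
open import Relation.Binary.PropositionalEquality
open import Relation.Nullary using (¬_; Dec; yes; no; does; contradiction)
open import Relation.Nullary.Decidable
  using (map; dec-true; dec-false; does-⇔; True; toWitness; _⊎-dec_)
open import Relation.Unary using (Decidable)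

form₁ form₃ : ℕ → ℕ → ℕ
form₁ k j = (4 * k + 1) * 2 ^ j
form₃ k j = (4 * k + 3) * 2 ^ j

-- InA⇔InAℕ below identifies A, for n = b + 2, with the residues satisfying InAℕ b.
InAℕ : ℕ → ℕ → Set
InAℕ b x = ∃[ k ] ∃[ j ] (j ≤ b × x ≡ form₁ k j)

*2^-suc : ∀ a j → a * 2 ^ suc j ≡ 2 * (a * 2 ^ j)
*2^-suc a j = lemma a (2 ^ j)
  where
  lemma : ∀ a p → a * (2 * p) ≡ 2 * (a * p)
  lemma = solve-∀

form₁-suc : ∀ k j → form₁ k (suc j) ≡ 2 * form₁ k j
form₁-suc k = *2^-suc (4 * k + 1)

form₃-suc : ∀ k j → form₃ k (suc j) ≡ 2 * form₃ k j
form₃-suc k = *2^-suc (4 * k + 3)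

form₁-zero : ∀ k → form₁ k 0 ≡ suc (2 * (2 * k))
form₁-zero = lemma
  where
  lemma : ∀ k → (4 * k + 1) * 1 ≡ 1 + 2 * (2 * k)
  lemma = solve-∀

form₃-zero : ∀ k → form₃ k 0 ≡ suc (2 * suc (2 * k))
form₃-zero = lemma
  where
  lemma : ∀ k → (4 * k + 3) * 1 ≡ 1 + 2 * (1 + 2 * k)
  lemma = solve-∀

0<form : ∀ k c j → 0 < (4 * k + suc c) * 2 ^ j
0<form k c j = *-mono-< (≤-<-trans z≤n (m<m+n (4 * k) z<s)) (m^n>0 2 j)

-- The odd part of a positive integer is well defined modulo 4.
form₁≢form₃ : ∀ k j k′ j′ → form₁ k j ≢ form₃ k′ j′
form₁≢form₃ k zero k′ zero eq =
  even≢odd k k′ (*-cancelˡ-≡ _ _ 2 (suc-injective (trans (sym (form₁-zero k)) (trans eq (form₃-zero k′)))))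
form₁≢form₃ k zero k′ (suc j′) eq =
  even≢odd (form₃ k′ j′) (2 * k) (sym (trans (sym (form₁-zero k)) (trans eq (form₃-suc k′ j′))))
form₁≢form₃ k (suc j) k′ zero eq =
  even≢odd (form₁ k j) (suc (2 * k′)) (trans (sym (form₁-suc k j)) (trans eq (form₃-zero k′)))
form₁≢form₃ k (suc j) k′ (suc j′) eq =
  form₁≢form₃ k j k′ j′ (*-cancelˡ-≡ _ _ 2 (trans (sym (form₁-suc k j)) (trans eq (form₃-suc k′ j′))))

form₃∉Aℕ : ∀ {b} k j → ¬ InAℕ b (form₃ k j)
form₃∉Aℕ k j (k′ , j′ , _ , eq) = form₁≢form₃ k′ j′ k j (sym eq)

2^-split : ∀ j d → 2 ^ (2 + (j + d)) ≡ 2 ^ j * (4 * 2 ^ d)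
2^-split j d = trans (cong (λ q → 2 * (2 * q)) (^-distribˡ-+-* 2 j d)) (lemma (2 ^ j) (2 ^ d))
  where
  lemma : ∀ p q → 2 * (2 * (p * q)) ≡ p * (4 * q)
  lemma = solve-∀

form₁<2^⇒< : ∀ k j d → form₁ k j < 2 ^ (2 + (j + d)) → k < 2 ^ d
form₁<2^⇒< k j d lt = *-cancelˡ-< 4 k (2 ^ d) (<-trans (m<m+n (4 * k) z<s) 4k+1<)
  where
  4k+1< : 4 * k + 1 < 4 * 2 ^ d
  4k+1< = *-cancelˡ-< (2 ^ j) _ _ (subst₂ _<_ (*-comm (4 * k + 1) (2 ^ j)) (2^-split j d) lt)

form₁<2^[2+j]⇒k≡0 : ∀ k j → form₁ k j < 2 ^ (2 + j) → k ≡ 0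
form₁<2^[2+j]⇒k≡0 k j lt =
  n<1⇒n≡0 (form₁<2^⇒< k j 0 (subst (λ e → form₁ k j < 2 ^ (2 + e)) (sym (+-identityʳ j)) lt))

form₁+form₃≡2^ : ∀ {k d} j → k < 2 ^ d → ∃[ t ] form₁ k j + form₃ t j ≡ 2 ^ (2 + (j + d))
form₁+form₃≡2^ {k} {d} j k<2^d with m≤n⇒∃[o]m+o≡n k<2^d
... | t , 1+k+t≡2^d = t , (begin
  form₁ k j + form₃ t j        ≡⟨ lemma k t (2 ^ j) ⟩
  2 ^ j * (4 * (suc k + t))    ≡⟨ cong (λ q → 2 ^ j * (4 * q)) 1+k+t≡2^d ⟩
  2 ^ j * (4 * 2 ^ d)          ≡⟨ 2^-split j d ⟨
  2 ^ (2 + (j + d))            ∎)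
  where
  open ≡-Reasoning
  lemma : ∀ k t p → (4 * k + 1) * p + (4 * t + 3) * p ≡ p * (4 * (1 + k + t))
  lemma = solve-∀

form₁+form₁≢2^ : ∀ {b} k j k′ j′ → j ≤ b → form₁ k j < 2 ^ (2 + b) →
                 form₁ k j + form₁ k′ j′ ≢ 2 ^ (2 + b)
form₁+form₁≢2^ k j k′ j′ j≤b lt eq with m≤n⇒∃[o]m+o≡n j≤b
... | d , refl with form₁+form₃≡2^ j (form₁<2^⇒< k j d lt)
... | t , sum≡ = form₁≢form₃ k′ j′ t j (+-cancelˡ-≡ (form₁ k j) _ _ (trans eq (sym sum≡)))

-- Sums within a parity class

form₁-+-far : ∀ k k′ j t → form₁ k j + form₁ k′ (2 + (j + t)) ≡ form₁ (k + form₁ k′ t) j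
form₁-+-far k k′ j t = begin
  form₁ k j + (4 * k′ + 1) * (2 * (2 * 2 ^ (j + t)))
    ≡⟨ cong (λ q → form₁ k j + (4 * k′ + 1) * (2 * (2 * q))) (^-distribˡ-+-* 2 j t) ⟩
  form₁ k j + (4 * k′ + 1) * (2 * (2 * (2 ^ j * 2 ^ t)))
    ≡⟨ lemma k k′ (2 ^ j) (2 ^ t) ⟩
  form₁ (k + form₁ k′ t) j ∎
  where
  open ≡-Reasoning
  lemma : ∀ k k′ p q → (4 * k + 1) * p + (4 * k′ + 1) * (2 * (2 * (p * q))) ≡
                       (4 * (k + (4 * k′ + 1) * q) + 1) * p
  lemma = solve-∀

form₁-+-near : ∀ k k′ s j → k + k′ ≡ s * 2 → form₁ k j + form₁ k′ j ≡ form₁ s (suc j)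
form₁-+-near k k′ s j k+k′≡ = begin
  form₁ k j + form₁ k′ j         ≡⟨ lemma₁ k k′ (2 ^ j) ⟩
  (4 * (k + k′) + 2) * 2 ^ j     ≡⟨ cong (λ m → (4 * m + 2) * 2 ^ j) k+k′≡ ⟩
  (4 * (s * 2) + 2) * 2 ^ j      ≡⟨ lemma₂ s (2 ^ j) ⟩
  form₁ s (suc j)                ∎
  where
  open ≡-Reasoning
  lemma₁ : ∀ k k′ p → (4 * k + 1) * p + (4 * k′ + 1) * p ≡ (4 * (k + k′) + 2) * p
  lemma₁ = solve-∀
  lemma₂ : ∀ s p → (4 * (s * 2) + 2) * p ≡ (4 * s + 1) * (2 * p)
  lemma₂ = solve-∀

InAℕ-+-far : ∀ {b} k k′ {j j′} → j ≤ b → suc j < j′ → InAℕ b (form₁ k j + form₁ k′ j′)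
InAℕ-+-far k k′ {j} j≤b 2+j≤j′ with m≤n⇒∃[o]m+o≡n 2+j≤j′
... | t , refl = k + form₁ k′ t , j , j≤b , form₁-+-far k k′ j t

InAℕ-+-near : ∀ {b} k k′ {j} → j < b → 2 ∣ k + k′ → InAℕ b (form₁ k j + form₁ k′ j)
InAℕ-+-near k k′ {j} j<b (divides s k+k′≡) = s , suc j , j<b , form₁-+-near k k′ s j k+k′≡

<∧parity≡⇒suc< : ∀ {j j′} → j < j′ → parity j ≡ parity j′ → suc j < j′
<∧parity≡⇒suc< {j} j<j′ eq =
  ≤∧≢⇒< j<j′ λ { refl → ℙₚ.p≢p⁻¹ (parity (suc j)) (sym (trans (ℙₚ.suc-homo-⁻¹ j) eq)) }

parity≡0ℙ⇒2∣ : ∀ n → parity n ≡ 0ℙ → 2 ∣ n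
parity≡0ℙ⇒2∣ zero          _  = divides 0 refl
parity≡0ℙ⇒2∣ (suc (suc n)) eq = ∣m∣n⇒∣m+n (n∣n {2}) (parity≡0ℙ⇒2∣ n eq)

parity≡⇒2∣+ : ∀ k k′ → parity k ≡ parity k′ → 2 ∣ k + k′
parity≡⇒2∣+ k k′ eq = parity≡0ℙ⇒2∣ (k + k′)
  (trans (ℙₚ.+-homo-+ k k′) (subst (λ p → p ℙ.+ parity k′ ≡ 0ℙ) (sym eq) (ℙₚ.p+p≡0ℙ (parity k′))))

parityIndex : Parity → Fin 2
parityIndex 0ℙ = zero
parityIndex 1ℙ = suc zero

parityIndex-injective : ∀ {p q} → parityIndex p ≡ parityIndex q → p ≡ q
parityIndex-injective {0ℙ} {0ℙ} _ = refl
parityIndex-injective {1ℙ} {1ℙ} _ = refl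

parityClass : ℕ → ℕ → Fin 4
parityClass k j = combine (parityIndex (parity j)) (parityIndex (parity k))

parityClass-injective : ∀ {k j k′ j′} → parityClass k j ≡ parityClass k′ j′ →
                        parity j ≡ parity j′ × parity k ≡ parity k′
parityClass-injective eq =
  Product.map parityIndex-injective parityIndex-injective (combine-injective _ _ _ _ eq)

classOf : ∀ {b x} → InAℕ b x → Fin 4
classOf (k , j , _) = parityClass k j

sameClass⇒InAℕ-+ : ∀ {b x y} (x∈A : InAℕ b x) (y∈A : InAℕ b y) →
  x < 2 ^ (2 + b) → y < 2 ^ (2 + b) → x ≢ y → classOf x∈A ≡ classOf y∈A → InAℕ b (x + y)
sameClass⇒InAℕ-+ {b} (k , j , j≤b , refl) (k′ , j′ , j′≤b , refl) x< y< x≢y same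
  with parity-j , parity-k ← parityClass-injective {k} {j} {k′} {j′} same
  with <-cmp j j′
... | tri< j<j′ _ _ = InAℕ-+-far k k′ j≤b (<∧parity≡⇒suc< j<j′ parity-j)
... | tri> _ _ j′<j = subst (InAℕ b) (+-comm (form₁ k′ j′) (form₁ k j))
                        (InAℕ-+-far k′ k j′≤b (<∧parity≡⇒suc< j′<j (sym parity-j)))
... | tri≈ _ refl _ = InAℕ-+-near k k′ j<b (parity≡⇒2∣+ k k′ parity-k)
  where
  j<b : j < b
  j<b = ≤∧≢⇒< j≤b λ { refl →
    x≢y (cong (λ m → form₁ m j) (trans (form₁<2^[2+j]⇒k≡0 k j x<) (sym (form₁<2^[2+j]⇒k≡0 k′ j y<)))) }

-- Halving and counting

data Half : ℕ → Set where
  even : ∀ y → Half (2 * y)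
  odd  : ∀ y → Half (suc (2 * y))

half : ∀ x → Half x
half zero = even 0
half (suc x) with half x
... | even y = odd y
... | odd y  = subst Half (*-suc 2 y) (even (suc y))

InAℕ-zero-double : ∀ y → ¬ InAℕ 0 (2 * y)
InAℕ-zero-double y (k , zero , _ , eq) = even≢odd y (2 * k) (trans eq (form₁-zero k))

InAℕ-suc-double : ∀ b y → InAℕ b y ⇔ InAℕ (suc b) (2 * y)
InAℕ-suc-double b y = mk⇔ to from
  where
  to : InAℕ b y → InAℕ (suc b) (2 * y)
  to (k , j , j≤b , eq) = k , suc j , s≤s j≤b , trans (cong (2 *_) eq) (sym (form₁-suc k j))
  from : InAℕ (suc b) (2 * y) → InAℕ b y
  from (k , zero , _ , eq) = ⊥-elim (even≢odd y (2 * k) (trans eq (form₁-zero k)))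
  from (k , suc j , s≤s j≤b , eq) = k , j , j≤b , *-cancelˡ-≡ y (form₁ k j) 2 (trans eq (form₁-suc k j))

InAℕ-odd : ∀ b y → 2 ∣ y ⇔ InAℕ b (suc (2 * y))
InAℕ-odd b y = mk⇔ to from
  where
  to : 2 ∣ y → InAℕ b (suc (2 * y))
  to (divides z y≡) = z , 0 , z≤n , trans (cong (λ m → suc (2 * m)) (trans y≡ (*-comm z 2))) (sym (form₁-zero z))
  from : InAℕ b (suc (2 * y)) → 2 ∣ y
  from (k , zero , _ , eq) =
    divides k (trans (*-cancelˡ-≡ y (2 * k) 2 (suc-injective (trans eq (form₁-zero k)))) (*-comm 2 k))
  from (k , suc j , _ , eq) = ⊥-elim (even≢odd (form₁ k j) y (sym (trans eq (form₁-suc k j))))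

InAℕ? : ∀ b → Decidable (InAℕ b)
InAℕ? b x with half x
InAℕ? zero    _ | even y = no (InAℕ-zero-double y)
InAℕ? (suc b) _ | even y = map (InAℕ-suc-double b y) (InAℕ? b y)
InAℕ? b       _ | odd y  = map (InAℕ-odd b y) (2 ∣? y)

count : (ℕ → Bool) → ℕ → ℕ
count f zero    = 0
count f (suc n) = (if f 0 then 1 else 0) + count (f ∘ suc) n

∣tabulate∣≡count : ∀ n (f : ℕ → Bool) → ∣ tabulate {n = n} (f ∘ toℕ) ∣ ≡ count f n
∣tabulate∣≡count zero    f = refl
∣tabulate∣≡count (suc n) f with f 0 | ∣tabulate∣≡count n (f ∘ suc)
... | true  | ih = cong suc ih
... | false | ih = ih

count-cong : ∀ {f g} n → (∀ i → f i ≡ g i) → count f n ≡ count g n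
count-cong zero    f≗g = refl
count-cong (suc n) f≗g = cong₂ _+_ (cong (λ c → if c then 1 else 0) (f≗g 0)) (count-cong n (f≗g ∘ suc))

count-false : ∀ {f} n → (∀ i → f i ≡ false) → count f n ≡ 0
count-false zero    f≗false = refl
count-false (suc n) f≗false rewrite f≗false 0 = count-false n (f≗false ∘ suc)

count-true : ∀ {f} n → (∀ i → f i ≡ true) → count f n ≡ n
count-true zero    f≗true = refl
count-true (suc n) f≗true rewrite f≗true 0 = cong suc (count-true n (f≗true ∘ suc))

count-+ : ∀ f m n → count f (m + n) ≡ count f m + count (λ i → f (m + i)) n
count-+ f zero    n = refl
count-+ f (suc m) n = trans (cong (λ c → (if f 0 then 1 else 0) + c) (count-+ (f ∘ suc) m n))
                            (sym (+-assoc (if f 0 then 1 else 0) _ _))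

count-false-beyond : ∀ f {m n} → m ≤ n → (∀ i → f (m + i) ≡ false) → count f n ≡ count f m
count-false-beyond f {m} m≤n f≗false with m≤n⇒∃[o]m+o≡n m≤n
... | o , refl = begin
  count f (m + o)                        ≡⟨ count-+ f m o ⟩
  count f m + count (λ i → f (m + i)) o  ≡⟨ cong (λ c → count f m + c) (count-false o f≗false) ⟩
  count f m + 0                          ≡⟨ +-identityʳ (count f m) ⟩
  count f m                              ∎
  where open ≡-Reasoning

count-double : ∀ f n → count f (2 * n) ≡ count (λ i → f (2 * i)) n + count (λ i → f (suc (2 * i))) n
count-double f zero    = refl
count-double f (suc n) = begin
  count f (2 * suc n)                        ≡⟨ cong (count f) (*-suc 2 n) ⟩
  a + (b + count (λ i → f (2 + i)) (2 * n))  ≡⟨ cong (λ c → a + (b + c)) (count-double (λ i → f (2 + i)) n) ⟩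
  a + (b + (count evens n + count odds n))   ≡⟨ interchange a b (count evens n) (count odds n) ⟩
  (a + count evens n) + (b + count odds n)   ≡⟨ cong₂ (λ c d → (a + c) + (b + d))
                                                  (count-cong n (λ i → cong f (sym (*-suc 2 i))))
                                                  (count-cong n (λ i → cong (f ∘ suc) (sym (*-suc 2 i)))) ⟩
  count (λ i → f (2 * i)) (suc n) + count (λ i → f (suc (2 * i))) (suc n) ∎
  where
  open ≡-Reasoning
  a b : ℕ
  a = if f 0 then 1 else 0
  b = if f 1 then 1 else 0
  evens odds : ℕ → Bool
  evens i = f (2 + 2 * i)
  odds i = f (3 + 2 * i)
  interchange : ∀ a b c d → a + (b + (c + d)) ≡ (a + c) + (b + d)
  interchange = solve-∀

count-2∣ : ∀ n → count (does ∘ (2 ∣?_)) (2 * n) ≡ n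
count-2∣ n = begin
  count (does ∘ (2 ∣?_)) (2 * n)
    ≡⟨ count-double (does ∘ (2 ∣?_)) n ⟩
  count (λ i → does (2 ∣? (2 * i))) n + count (λ i → does (2 ∣? suc (2 * i))) n
    ≡⟨ cong₂ _+_ (count-true n (λ i → dec-true (2 ∣? _) (divides i (*-comm 2 i))))
                 (count-false n (λ i → dec-false (2 ∣? _) (2∤odd i))) ⟩
  n + 0
    ≡⟨ +-identityʳ n ⟩
  n ∎
  where
  open ≡-Reasoning
  2∤odd : ∀ i → ¬ 2 ∣ suc (2 * i)
  2∤odd i (divides q eq) = even≢odd q i (sym (trans eq (*-comm q 2)))

countA : ℕ → ℕ
countA b = count (does ∘ InAℕ? b) (2 ^ (2 + b))

suc-countA : ∀ b → suc (countA b) ≡ 2 ^ (1 + b)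
suc-countA zero    = refl
suc-countA (suc b) = begin
  suc (countA (suc b))
    ≡⟨ cong suc (count-double (does ∘ InAℕ? (suc b)) (2 ^ (2 + b))) ⟩
  suc (count (λ y → does (InAℕ? (suc b) (2 * y))) (2 ^ (2 + b))
       + count (λ y → does (InAℕ? (suc b) (suc (2 * y)))) (2 ^ (2 + b)))
    ≡⟨ cong₂ (λ c d → suc (c + d))
         (count-cong (2 ^ (2 + b)) (λ y → sym (does-⇔ (InAℕ-suc-double b y) (InAℕ? b y) (InAℕ? (suc b) _))))
         (trans (count-cong (2 ^ (2 + b)) (λ y → sym (does-⇔ (InAℕ-odd (suc b) y) (2 ∣? y) (InAℕ? (suc b) _))))
                (count-2∣ (2 ^ (1 + b)))) ⟩
  suc (countA b) + 2 ^ (1 + b)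
    ≡⟨ cong (_+ 2 ^ (1 + b)) (suc-countA b) ⟩
  2 ^ (1 + b) + 2 ^ (1 + b)
    ≡⟨ cong (λ c → 2 ^ (1 + b) + c) (sym (+-identityʳ (2 ^ (1 + b)))) ⟩
  2 ^ (2 + b) ∎
  where open ≡-Reasoning

-- From integers to residues

pos-form : ∀ c k j → + ((4 * k + c) * 2 ^ j) ≡ (+ 4 ℤ.* + k ℤ.+ + c) ℤ.* + 2 ^ j
pos-form c k j = begin
  + ((4 * k + c) * 2 ^ j)             ≡⟨ ℤ.pos-* (4 * k + c) (2 ^ j) ⟩
  + (4 * k + c) ℤ.* + 2 ^ j           ≡⟨ cong (ℤ._* + 2 ^ j) (ℤ.pos-+ (4 * k) c) ⟩
  (+ (4 * k) ℤ.+ + c) ℤ.* + 2 ^ j     ≡⟨ cong (λ z → (z ℤ.+ + c) ℤ.* + 2 ^ j) (ℤ.pos-* 4 k) ⟩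
  (+ 4 ℤ.* + k ℤ.+ + c) ℤ.* + 2 ^ j   ∎
  where open ≡-Reasoning

+≡[4m+1]*2^j⇒form₁ : ∀ {r} m j → + r ≡ (+ 4 ℤ.* m ℤ.+ + 1) ℤ.* + 2 ^ j → ∃[ k ] r ≡ form₁ k j
+≡[4m+1]*2^j⇒form₁ (+ k) j eq = k , ℤ.+-injective (trans eq (sym (pos-form 1 k j)))
+≡[4m+1]*2^j⇒form₁ {r} -[1+ t ] j eq = ⊥-elim (+≢-pos (0<form t 2 j) (begin
  + r                                             ≡⟨ eq ⟩
  (+ 4 ℤ.* ℤ.- (+ 1 ℤ.+ + t) ℤ.+ + 1) ℤ.* + 2 ^ j ≡⟨ lemma (+ t) (+ 2 ^ j) ⟩
  ℤ.- ((+ 4 ℤ.* + t ℤ.+ + 3) ℤ.* + 2 ^ j)         ≡⟨ cong ℤ.-_ (pos-form 3 t j) ⟨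
  ℤ.- + form₃ t j                                 ∎))
  where
  open ≡-Reasoning
  lemma : ∀ t p → (+ 4 ℤ.* ℤ.- (+ 1 ℤ.+ t) ℤ.+ + 1) ℤ.* p ≡ ℤ.- ((+ 4 ℤ.* t ℤ.+ + 3) ℤ.* p)
  lemma = ℤ-Solver.solve-∀
  +≢-pos : ∀ {n} → 0 < n → + r ≢ ℤ.- + n
  +≢-pos {suc n} _ ()

-- Reducing (4m+1)·2^j modulo 2^(j+d+2) only changes m by a multiple of 2^d.
form₁-%ℕ : ∀ m j d → ∃[ k ] _%ℕ_ ((+ 4 ℤ.* m ℤ.+ + 1) ℤ.* + 2 ^ j) (2 ^ (2 + (j + d)))
                                 {{2^n-nonZero (2 + (j + d))}} ≡ form₁ k j
form₁-%ℕ m j d = +≡[4m+1]*2^j⇒form₁ (m ℤ.- q ℤ.* D) j (begin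
  + r                                           ≡⟨ lemma₁ (+ r) q P D ⟩
  (+ r ℤ.+ q ℤ.* P·4D) ℤ.- q ℤ.* P·4D           ≡⟨ cong (ℤ._- q ℤ.* P·4D) z≡ ⟨
  z ℤ.- q ℤ.* P·4D                              ≡⟨ lemma₂ m q P D ⟩
  (+ 4 ℤ.* (m ℤ.- q ℤ.* D) ℤ.+ + 1) ℤ.* P       ∎)
  where
  open ≡-Reasoning
  N = 2 ^ (2 + (j + d))
  P = + 2 ^ j
  D = + 2 ^ d
  P·4D = P ℤ.* (+ 4 ℤ.* D)
  z = (+ 4 ℤ.* m ℤ.+ + 1) ℤ.* P
  r = _%ℕ_ z N {{2^n-nonZero (2 + (j + d))}}
  q = _/ℕ_ z N {{2^n-nonZero (2 + (j + d))}}
  +N≡ : + N ≡ P·4D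
  +N≡ = trans (cong +_ (2^-split j d)) (trans (ℤ.pos-* (2 ^ j) (4 * 2 ^ d)) (cong (P ℤ.*_) (ℤ.pos-* 4 (2 ^ d))))
  z≡ : z ≡ + r ℤ.+ q ℤ.* P·4D
  z≡ = trans (a≡a%ℕn+[a/ℕn]*n z N {{2^n-nonZero (2 + (j + d))}}) (cong (λ n → + r ℤ.+ q ℤ.* n) +N≡)
  lemma₁ : ∀ r q p d → r ≡ (r ℤ.+ q ℤ.* (p ℤ.* (+ 4 ℤ.* d))) ℤ.- q ℤ.* (p ℤ.* (+ 4 ℤ.* d))
  lemma₁ = ℤ-Solver.solve-∀
  lemma₂ : ∀ m q p d → (+ 4 ℤ.* m ℤ.+ + 1) ℤ.* p ℤ.- q ℤ.* (p ℤ.* (+ 4 ℤ.* d)) ≡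
                       (+ 4 ℤ.* (m ℤ.- q ℤ.* d) ℤ.+ + 1) ℤ.* p
  lemma₂ = ℤ-Solver.solve-∀

toℕ-toG : ∀ n v → toℕ (toG n v) ≡ _%_ v (2 ^ n) {{2^n-nonZero n}}
toℕ-toG n v = toℕ-fromℕ< _

InAℕ⇒InA : ∀ b (x : G (2 + b)) {v} → InAℕ b v → toℕ x ≡ _%_ v (2 ^ (2 + b)) {{2^n-nonZero (2 + b)}} →
           InA (2 + b) x
InAℕ⇒InA b x (k , j , j≤b , refl) x≡ =
  + k , j , j≤b , trans x≡ (cong (λ z → _%ℕ_ z (2 ^ (2 + b)) {{2^n-nonZero (2 + b)}}) (pos-form 1 k j))

InA⇒InAℕ : ∀ b (x : G (2 + b)) → InA (2 + b) x → InAℕ b (toℕ x)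
InA⇒InAℕ b x (m , j , j≤b , x≡) with m≤n⇒∃[o]m+o≡n j≤b
... | d , refl = proj₁ reduced , j , j≤b , trans x≡ (proj₂ reduced)
  where reduced = form₁-%ℕ m j d

InA⇔InAℕ : ∀ b (x : G (2 + b)) → InA (2 + b) x ⇔ InAℕ b (toℕ x)
InA⇔InAℕ b x = mk⇔ (InA⇒InAℕ b x)
  (λ x∈A → InAℕ⇒InA b x x∈A (sym (m<n⇒m%n≡m {{2^n-nonZero (2 + b)}} (toℕ<n x))))

[m+n]%o≡0⇒m+n≡o : ∀ {m n o} .{{_ : NonZero o}} → 0 < m → m < o → n < o → (m + n) % o ≡ 0 → m + n ≡ o
[m+n]%o≡0⇒m+n≡o {m} {n} {o} 0<m m<o n<o eq with m%n≡0⇒n∣m (m + n) o eq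
... | divides zero          e = contradiction (m+n≡0⇒m≡0 m e) (>⇒≢ 0<m)
... | divides (suc zero)    e = trans e (+-identityʳ o)
... | divides (suc (suc q)) e =
  contradiction (+-mono-< m<o n<o) (≤⇒≯ (subst (o + o ≤_) (sym e) (+-monoʳ-≤ o (m≤m+n o (q * o)))))

injectiveOn⇒∣p∣≤ : ∀ {n m} (p : Subset n) (f : ∀ x → x ∈ p → Fin m) →
  (∀ {x y} (x∈p : x ∈ p) (y∈p : y ∈ p) → f x x∈p ≡ f y y∈p → x ≡ y) → ∣ p ∣ ≤ m
injectiveOn⇒∣p∣≤ [] f f-inj = z≤n
injectiveOn⇒∣p∣≤ (outside ∷ p) f f-inj = injectiveOn⇒∣p∣≤ p (λ x x∈p → f (suc x) (there x∈p))
  (λ x∈p y∈p eq → Fin-suc-injective (f-inj (there x∈p) (there y∈p) eq))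
injectiveOn⇒∣p∣≤ {m = zero} (inside ∷ p) f f-inj with f zero here
... | ()
injectiveOn⇒∣p∣≤ {m = suc m} (inside ∷ p) f f-inj = s≤s (injectiveOn⇒∣p∣≤ p g g-inj)
  where
  f₀≢ : ∀ {x} (x∈p : x ∈ p) → f zero here ≢ f (suc x) (there x∈p)
  f₀≢ x∈p eq = Fin-0≢1+n (f-inj here (there x∈p) eq)
  g : ∀ x → x ∈ p → Fin m
  g x x∈p = punchOut (f₀≢ x∈p)
  g-inj : ∀ {x y} (x∈p : x ∈ p) (y∈p : y ∈ p) → g x x∈p ≡ g y y∈p → x ≡ y
  g-inj x∈p y∈p eq =
    Fin-suc-injective (f-inj (there x∈p) (there y∈p) (punchOut-injective (f₀≢ x∈p) (f₀≢ y∈p) eq))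

∈-tabulate-does : ∀ {n} {P : Fin n → Set} (P? : ∀ x → Dec (P x)) x →
                  x ∈ tabulate (λ y → does (P? y)) ⇔ P x
∈-tabulate-does P? x = mk⇔
  (λ x∈ → does≡true⇒ (P? x) (trans (sym (lookup∘tabulate _ x)) ([]=⇒lookup x∈)))
  (λ Px → lookup⇒[]= x _ (trans (lookup∘tabulate _ x) (dec-true (P? x) Px)))
  where
  does≡true⇒ : ∀ {A : Set} (a? : Dec A) → does a? ≡ true → A
  does≡true⇒ (yes a) _ = a

-- The three assertions, for n = b + 2

Aˢ : ∀ b → Subset (2 ^ (2 + b))
Aˢ b = tabulate (λ x → does (InAℕ? b (toℕ x)))

∈Aˢ⇔InA : ∀ b x → x ∈ Aˢ b ⇔ InA (2 + b) x
∈Aˢ⇔InA b x = ⇔.trans (∈-tabulate-does (InAℕ? b ∘ toℕ) x) (⇔.sym (InA⇔InAℕ b x))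

∣Aˢ∣≡2^[1+b]∸1 : ∀ b → ∣ Aˢ b ∣ ≡ 2 ^ (1 + b) ∸ 1
∣Aˢ∣≡2^[1+b]∸1 b = trans (∣tabulate∣≡count (2 ^ (2 + b)) (does ∘ InAℕ? b)) (cong (_∸ 1) (suc-countA b))

φ≤4 : ∀ b (B : Subset (2 ^ (2 + b))) → SubsetOfA (2 + b) B → SumAvoiding (2 + b) B → ∣ B ∣ ≤ 4
φ≤4 b B B⊆A avoiding = injectiveOn⇒∣p∣≤ B class class-injective
  where
  shape : ∀ {x} → x ∈ B → InAℕ b (toℕ x)
  shape {x} x∈B = InA⇒InAℕ b x (B⊆A x x∈B)
  class : ∀ x → x ∈ B → Fin 4
  class x x∈B = classOf (shape x∈B)
  class-injective : ∀ {x y} (x∈B : x ∈ B) (y∈B : y ∈ B) → class x x∈B ≡ class y y∈B → x ≡ y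
  class-injective {x} {y} x∈B y∈B same with x Fin.≟ y
  ... | yes x≡y = x≡y
  ... | no x≢y = contradiction x+y∈A (avoiding x y x∈B y∈B x≢y)
    where
    x+y∈A : InA (2 + b) (addG (2 + b) x y)
    x+y∈A = InAℕ⇒InA b _
      (sameClass⇒InAℕ-+ (shape x∈B) (shape y∈B) (toℕ<n x) (toℕ<n y) (x≢y ∘ toℕ-injective) same)
      (toℕ-toG (2 + b) _)

no-zero-sum : ∀ b → ¬ (∃[ a₁ ] ∃[ a₂ ] (InA (2 + b) a₁ × InA (2 + b) a₂ × addG (2 + b) a₁ a₂ ≡ 0G (2 + b)))
no-zero-sum b (a₁ , a₂ , a₁∈A , a₂∈A , a₁+a₂≡0) with InA⇒InAℕ b a₁ a₁∈A | InA⇒InAℕ b a₂ a₂∈A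
... | k , j , j≤b , a₁≡ | k′ , j′ , _ , a₂≡ =
  form₁+form₁≢2^ k j k′ j′ j≤b (subst (_< 2 ^ (2 + b)) a₁≡ (toℕ<n a₁)) (begin
    form₁ k j + form₁ k′ j′  ≡⟨ cong₂ _+_ a₁≡ a₂≡ ⟨
    toℕ a₁ + toℕ a₂          ≡⟨ [m+n]%o≡0⇒m+n≡o {{2^n-nonZero (2 + b)}} 0<a₁ (toℕ<n a₁) (toℕ<n a₂) sum%≡0 ⟩
    2 ^ (2 + b)              ∎)
  where
  open ≡-Reasoning
  0<a₁ : 0 < toℕ a₁
  0<a₁ = subst (0 <_) (sym a₁≡) (0<form k 0 j)
  sum%≡0 : _%_ (toℕ a₁ + toℕ a₂) (2 ^ (2 + b)) {{2^n-nonZero (2 + b)}} ≡ 0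
  sum%≡0 = begin
    _                        ≡⟨ toℕ-toG (2 + b) _ ⟨
    toℕ (addG (2 + b) a₁ a₂) ≡⟨ cong toℕ a₁+a₂≡0 ⟩
    toℕ (0G (2 + b))         ≡⟨ toℕ-toG (2 + b) 0 ⟩
    _                        ≡⟨ m<n⇒m%n≡m {{2^n-nonZero (2 + b)}} (m^n>0 2 (2 + b)) ⟩
    0                        ∎

InB₄ : ℕ → Set
InB₄ x = x ≡ 1 ⊎ x ≡ 2 ⊎ x ≡ 5 ⊎ x ≡ 10

InB₄? : Decidable InB₄
InB₄? x = x ≟ 1 ⊎-dec x ≟ 2 ⊎-dec x ≟ 5 ⊎-dec x ≟ 10

pattern one  = inj₁ refl
pattern two  = inj₂ (inj₁ refl)
pattern five = inj₂ (inj₂ (inj₁ refl))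
pattern ten  = inj₂ (inj₂ (inj₂ refl))

B₄ : ∀ n → Subset (2 ^ n)
B₄ n = tabulate (λ x → does (InB₄? (toℕ x)))

∈B₄⇒InB₄ : ∀ {n} {x : Fin (2 ^ n)} → x ∈ B₄ n → InB₄ (toℕ x)
∈B₄⇒InB₄ {x = x} = Equivalence.to (∈-tabulate-does (InB₄? ∘ toℕ) x)

InB₄⇒InAℕ : ∀ {b x} → InB₄ x → InAℕ (suc b) x
InB₄⇒InAℕ one  = 0 , 0 , z≤n , refl
InB₄⇒InAℕ two  = 0 , 1 , s≤s z≤n , refl
InB₄⇒InAℕ five = 1 , 0 , z≤n , refl
InB₄⇒InAℕ ten  = 1 , 1 , s≤s z≤n , refl

InB₄-sum : ∀ {x y} → InB₄ x → InB₄ y → x ≢ y → True (x + y <? 16) × ∃[ k ] ∃[ j ] x + y ≡ form₃ k j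
InB₄-sum one  one  x≢y = contradiction refl x≢y
InB₄-sum one  two  _   = _ , 0 , 0 , refl
InB₄-sum one  five _   = _ , 0 , 1 , refl
InB₄-sum one  ten  _   = _ , 2 , 0 , refl
InB₄-sum two  one  _   = _ , 0 , 0 , refl
InB₄-sum two  two  x≢y = contradiction refl x≢y
InB₄-sum two  five _   = _ , 1 , 0 , refl
InB₄-sum two  ten  _   = _ , 0 , 2 , refl
InB₄-sum five one  _   = _ , 0 , 1 , refl
InB₄-sum five two  _   = _ , 1 , 0 , refl
InB₄-sum five five x≢y = contradiction refl x≢y
InB₄-sum five ten  _   = _ , 3 , 0 , refl
InB₄-sum ten  one  _   = _ , 2 , 0 , refl
InB₄-sum ten  two  _   = _ , 0 , 2 , refl
InB₄-sum ten  five _   = _ , 3 , 0 , refl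
InB₄-sum ten  ten  x≢y = contradiction refl x≢y

16≤2^[4+b] : ∀ b → 16 ≤ 2 ^ (4 + b)
16≤2^[4+b] b = subst (16 ≤_) (sym (^-distribˡ-+-* 2 4 b)) (m≤m*n 16 (2 ^ b) {{2^n-nonZero b}})

∣B₄∣≡4 : ∀ b → ∣ B₄ (4 + b) ∣ ≡ 4
∣B₄∣≡4 b = begin
  ∣ B₄ (4 + b) ∣                      ≡⟨ ∣tabulate∣≡count (2 ^ (4 + b)) (does ∘ InB₄?) ⟩
  count (does ∘ InB₄?) (2 ^ (4 + b))  ≡⟨ count-false-beyond (does ∘ InB₄?) (16≤2^[4+b] b)
                                           (λ i → dec-false (InB₄? (16 + i)) ∉B₄) ⟩
  count (does ∘ InB₄?) 16             ≡⟨⟩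
  4                                   ∎
  where
  open ≡-Reasoning
  ∉B₄ : ∀ {i} → ¬ InB₄ (16 + i)
  ∉B₄ (inj₁ ())
  ∉B₄ (inj₂ (inj₁ ()))
  ∉B₄ (inj₂ (inj₂ (inj₁ ())))
  ∉B₄ (inj₂ (inj₂ (inj₂ ())))

B₄⊆A : ∀ b → SubsetOfA (4 + b) (B₄ (4 + b))
B₄⊆A b x x∈B₄ = Equivalence.from (InA⇔InAℕ (2 + b) x) (InB₄⇒InAℕ (∈B₄⇒InB₄ {4 + b} x∈B₄))

B₄-sumAvoiding : ∀ b → SumAvoiding (4 + b) (B₄ (4 + b))
B₄-sumAvoiding b x y x∈B₄ y∈B₄ x≢y x+y∈A
  with InB₄-sum (∈B₄⇒InB₄ {4 + b} x∈B₄) (∈B₄⇒InB₄ {4 + b} y∈B₄) (x≢y ∘ toℕ-injective)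
... | x+y<16 , k , j , x+y≡ = form₃∉Aℕ k j (subst (InAℕ (2 + b)) toℕ[x+y]≡ (InA⇒InAℕ (2 + b) _ x+y∈A))
  where
  open ≡-Reasoning
  toℕ[x+y]≡ : toℕ (addG (4 + b) x y) ≡ form₃ k j
  toℕ[x+y]≡ = begin
    toℕ (addG (4 + b) x y)  ≡⟨ toℕ-toG (4 + b) _ ⟩
    _                       ≡⟨ m<n⇒m%n≡m {{2^n-nonZero (4 + b)}} (<-≤-trans (toWitness x+y<16) (16≤2^[4+b] b)) ⟩
    toℕ x + toℕ y           ≡⟨ x+y≡ ⟩
    form₃ k j               ∎

proposition4p2 : (n : ℕ) → 4 ≤ n →
    ((∃[ B ] (SubsetOfA n B × SumAvoiding n B × ∣ B ∣ ≡ 4)) ×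
     (∀ (B : Subset (2 ^ n)) → SubsetOfA n B → SumAvoiding n B → ∣ B ∣ ≤ 4)) ×
    (∃[ S ] ((∀ x → (x ∈ S ⇔ InA n x)) × ∣ S ∣ ≡ 2 ^ (n ∸ 1) ∸ 1)) ×
    ¬ (∃[ a₁ ] ∃[ a₂ ] (InA n a₁ × InA n a₂ × addG n a₁ a₂ ≡ 0G n))
proposition4p2 (suc (suc (suc (suc b)))) (s≤s (s≤s (s≤s (s≤s z≤n)))) =
  ((B₄ (4 + b) , B₄⊆A b , B₄-sumAvoiding b , ∣B₄∣≡4 b) , φ≤4 (2 + b)) ,
  (Aˢ (2 + b) , ∈Aˢ⇔InA (2 + b) , ∣Aˢ∣≡2^[1+b]∸1 (2 + b)) ,
  no-zero-sum (2 + b)
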